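{- Let $q$ be a prime power, $\mathrm{PG}(3,q)=\mathrm{AG}(3,q)\cup H_\infty$, and let $U\subset\mathrm{AG}(3,q)$ with $|U|=q^2$, $U$ not contained in a plane. Let $\ell_1,\ell_2$ be two distinct lines of $H_\infty$ not determined by $U$, and let $M=\ell_1\cap\ell_2$. If there is an affine line contained in $U$ whose ideal point is $M$, then every affine line contained in $U$ whose ideal point lies on $\ell_1$ has ideal point $M$.
   Context: A line $\ell\subset H_\infty$ is determined by $U$ if some affine plane whose line at infinity is $\ell$ contains three non-collinear points of $U$. Since $|U|=q^2$, if $\ell$ is not determined then each of the $q$ affine planes through $\ell$ meets $U$ in exactly one complete affine line. The ideal point of an affine line is its point at infinity. -}

module Defs where

open import Level using (0ℓ)
open import Data.Nat using (ℕ; _*_)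
open import Data.Fin using (Fin)
open import Data.Product using (_×_; _,_; Σ; ∃; ∃-syntax)
open import Data.Sum using (_⊎_)
open import Data.List using (List; length)
open import Data.List.Membership.Propositional using (_∈_)
open import Data.List.Relation.Unary.Unique.Propositional using (Unique)
open import Relation.Nullary using (¬_)
open import Relation.Binary.PropositionalEquality using (_≡_; _≢_)
open import Algebra.Structures using (IsCommutativeRing)
open import Function.Bundles using (_↔_)

-- A finite field with q elements (propositional equality on the carrier).
-- The number of elements q of a finite field is automatically a prime power.
record FiniteField : Set₁ where
  field
    Carrier : Set
    _+_ _·_ : Carrier → Carrier → Carrier
    -_      : Carrier → Carrier
    0# 1#   : Carrier
    isCommutativeRing : IsCommutativeRing _≡_ _+_ _·_ -_ 0# 1#
    0≢1     : 0# ≢ 1#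
    inv     : ∀ x → x ≢ 0# → ∃[ y ] (x · y ≡ 1#)
    q       : ℕ
    enum    : Fin q ↔ Carrier

module Geometry (F : FiniteField) where
  open FiniteField F

  infixl 6 _⊕_ _⊖_
  infixl 7 _⊙_

  -- points of AG(3,q) = F³; also used for vectors / homogeneous coordinates
  record V3 : Set where
    constructor v3
    field x y z : Carrier
  open V3 public

  _⊕_ : V3 → V3 → V3
  v3 a b c ⊕ v3 a' b' c' = v3 (a + a') (b + b') (c + c')

  _⊖_ : V3 → V3 → V3
  v3 a b c ⊖ v3 a' b' c' = v3 (a + (- a')) (b + (- b')) (c + (- c'))

  _⊙_ : Carrier → V3 → V3
  t ⊙ v3 a b c = v3 (t · a) (t · b) (t · c)

  dot : V3 → V3 → Carrier
  dot (v3 a b c) (v3 a' b' c') = (a · a') + ((b · b') + (c · c'))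

  zero3 : V3
  zero3 = v3 0# 0# 0#

  NonZero3 : V3 → Set
  NonZero3 v = v ≢ zero3

  -- Points of H∞ are nonzero directions d (up to scalar).
  -- Lines of H∞ are given by a nonzero normal n (up to scalar):
  -- the direction d lies on the line n iff dot n d ≡ 0#.
  OnLine∞ : (n d : V3) → Set
  OnLine∞ n d = dot n d ≡ 0#

  SameLine∞ : (n₁ n₂ : V3) → Set
  SameLine∞ n₁ n₂ = ∃[ t ] (t ≢ 0# × n₂ ≡ t ⊙ n₁)

  -- the affine plane {x | dot n x = k} has line at infinity n
  InPlane : (n : V3) (k : Carrier) (p : V3) → Set
  InPlane n k p = dot n p ≡ k

  Collinear : V3 → V3 → V3 → Set
  Collinear a b c =
    ∃[ λ₁ ] ∃[ μ ] ((λ₁ ≢ 0# ⊎ μ ≢ 0#) × (λ₁ ⊙ (b ⊖ a)) ⊕ (μ ⊙ (c ⊖ a)) ≡ zero3)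

  Determined : List V3 → V3 → Set
  Determined U n =
    ∃[ k ] ∃[ a ] ∃[ b ] ∃[ c ]
      ( a ∈ U × b ∈ U × c ∈ U
      × InPlane n k a × InPlane n k b × InPlane n k c
      × ¬ Collinear a b c )

  ContainedInPlane : List V3 → Set
  ContainedInPlane U = ∃[ n ] ∃[ k ] (NonZero3 n × (∀ p → p ∈ U → InPlane n k p))

  -- the affine line {p + t d} (d ≠ 0) is contained in U; its ideal point is d
  LineInU : List V3 → (p d : V3) → Set
  LineInU U p d = NonZero3 d × (∀ t → (p ⊕ (t ⊙ d)) ∈ U)

{-# OPTIONS --safe #-}
module Submission where

-- Let L₀ be the line of U with ideal point M = ℓ₁ ∩ ℓ₂, and suppose a line L ⊆ U
-- has ideal point on ℓ₁ but not on ℓ₂. Then L meets the plane π₂ spanned by L₀ and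
-- ℓ₂ in a point X of U. As ℓ₂ is not determined, X lies on L₀, so X is also in the
-- plane π₁ spanned by L₀ and ℓ₁, and hence all of L lies in π₁. As ℓ₁ is not
-- determined, every point of L then lies on L₀, hence in π₂: L ⊆ π₂ forces the
-- ideal point of L onto ℓ₂, a contradiction.

open import Defs
open import Level using (0ℓ)
open import Data.Nat using (_*_)
open import Data.Fin.Properties using (inj⇒≟)
open import Data.List using (List; length)
open import Data.List.Membership.Propositional using (_∈_)
open import Data.List.Relation.Unary.Unique.Propositional using (Unique)
open import Data.Maybe using (nothing)
open import Data.Product using (_,_; ∃-syntax)
open import Data.Sum using (fromInj₁)
open import Function.Properties.Inverse using (↔⇒↣; ↔-sym)
open import Relation.Nullary using (¬_; yes; no; contradiction)
open import Relation.Nullary.Decidable using (decidable-stable)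
open import Relation.Binary.Definitions using (DecidableEquality)
open import Relation.Binary.PropositionalEquality
open import Algebra.Bundles using (CommutativeRing)
open import Tactic.RingSolver.Core.AlmostCommutativeRing using (AlmostCommutativeRing; fromCommutativeRing)

module GeometryProperties (F : FiniteField) where
  open FiniteField F
  open Geometry F
  open ≡-Reasoning

  private
    commutativeRing : CommutativeRing 0ℓ 0ℓ
    commutativeRing = record { isCommutativeRing = isCommutativeRing }

    almostCommutativeRing : AlmostCommutativeRing 0ℓ 0ℓ
    almostCommutativeRing = fromCommutativeRing commutativeRing (λ _ → nothing)

  open CommutativeRing commutativeRing
    using ( +-assoc; +-identityˡ; +-identityʳ; -‿inverseˡ; -‿inverseʳ
          ; *-assoc; *-comm; *-identityˡ; *-identityʳ; distribʳ; zeroˡ; zeroʳ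
          ; ring; +-abelianGroup )
  open import Algebra.Properties.AbelianGroup +-abelianGroup
    using (x∙y⁻¹≈ε⇒x≈y; x≈y⇒x∙y⁻¹≈ε; xyx⁻¹≈y; inverseˡ-unique; ∙-cancelˡ)
  open import Algebra.Properties.Ring ring using (-‿distribˡ-*)
  open import Tactic.RingSolver.NonReflective almostCommutativeRing
    using (solve; _⊜_) renaming (_⊕_ to _:+_; _⊗_ to _:*_)

  infixl 6 _-_
  _-_ : Carrier → Carrier → Carrier
  a - b = a + (- b)

  _≟_ : DecidableEquality Carrier
  _≟_ = inj⇒≟ (↔⇒↣ (↔-sym enum))

  x-y≡0⇒x≡y : ∀ {a b} → a - b ≡ 0# → a ≡ b
  x-y≡0⇒x≡y = x∙y⁻¹≈ε⇒x≈y _ _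

  x≢y⇒x-y≢0 : ∀ {a b} → a ≢ b → a - b ≢ 0#
  x≢y⇒x-y≢0 a≢b a-b≡0 = a≢b (x-y≡0⇒x≡y a-b≡0)

  x+1≢x : ∀ a → a + 1# ≢ a
  x+1≢x a a+1≡a = 0≢1 (begin
    0#            ≡⟨ -‿inverseʳ a ⟨
    a - a         ≡⟨ cong (_- a) a+1≡a ⟨
    (a + 1#) - a  ≡⟨ xyx⁻¹≈y a 1# ⟩
    1#            ∎)

  x·y≡0⇒y≡0 : ∀ {a b} → a ≢ 0# → a · b ≡ 0# → b ≡ 0#
  x·y≡0⇒y≡0 {a} {b} a≢0 ab≡0 with inv a a≢0
  ... | a⁻¹ , aa⁻¹≡1 = begin
    b              ≡⟨ *-identityˡ b ⟨
    1# · b         ≡⟨ cong (_· b) (trans (sym aa⁻¹≡1) (*-comm a a⁻¹)) ⟩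
    (a⁻¹ · a) · b  ≡⟨ *-assoc a⁻¹ a b ⟩
    a⁻¹ · (a · b)  ≡⟨ cong (a⁻¹ ·_) ab≡0 ⟩
    a⁻¹ · 0#       ≡⟨ zeroʳ a⁻¹ ⟩
    0#             ∎

  x+[y-x]·z⁻¹·z≡y : ∀ {a b c c⁻¹} → c · c⁻¹ ≡ 1# → a + (((b - a) · c⁻¹) · c) ≡ b
  x+[y-x]·z⁻¹·z≡y {a} {b} {c} {c⁻¹} cc⁻¹≡1 = begin
    a + (((b - a) · c⁻¹) · c)  ≡⟨ cong (a +_) (*-assoc (b - a) c⁻¹ c) ⟩
    a + ((b - a) · (c⁻¹ · c))  ≡⟨ cong (λ w → a + ((b - a) · w)) (trans (*-comm c⁻¹ c) cc⁻¹≡1) ⟩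
    a + ((b - a) · 1#)         ≡⟨ cong (a +_) (*-identityʳ (b - a)) ⟩
    a + (b - a)                ≡⟨ +-assoc a b (- a) ⟨
    (a + b) - a                ≡⟨ xyx⁻¹≈y a b ⟩
    b                          ∎

  dot-⊕ : ∀ n u v → dot n (u ⊕ v) ≡ dot n u + dot n v
  dot-⊕ (v3 a b c) (v3 u₁ u₂ u₃) (v3 v₁ v₂ v₃) =
    solve 9 (λ a b c u₁ u₂ u₃ v₁ v₂ v₃ →
      (a :* (u₁ :+ v₁)) :+ ((b :* (u₂ :+ v₂)) :+ (c :* (u₃ :+ v₃)))
      ⊜ (((a :* u₁) :+ ((b :* u₂) :+ (c :* u₃))) :+ ((a :* v₁) :+ ((b :* v₂) :+ (c :* v₃)))))
      refl a b c u₁ u₂ u₃ v₁ v₂ v₃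

  dot-⊙ : ∀ n t v → dot n (t ⊙ v) ≡ t · dot n v
  dot-⊙ (v3 a b c) t (v3 v₁ v₂ v₃) =
    solve 7 (λ a b c t v₁ v₂ v₃ →
      (a :* (t :* v₁)) :+ ((b :* (t :* v₂)) :+ (c :* (t :* v₃)))
      ⊜ (t :* ((a :* v₁) :+ ((b :* v₂) :+ (c :* v₃)))))
      refl a b c t v₁ v₂ v₃

  dot-zero3 : ∀ n → dot n zero3 ≡ 0#
  dot-zero3 (v3 a b c) = begin
    (a · 0#) + ((b · 0#) + (c · 0#))  ≡⟨ cong₂ _+_ (zeroʳ a) (cong₂ _+_ (zeroʳ b) (zeroʳ c)) ⟩
    0# + (0# + 0#)                    ≡⟨ +-identityˡ (0# + 0#) ⟩
    0# + 0#                           ≡⟨ +-identityˡ 0# ⟩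
    0#                                ∎

  dot-⊖ : ∀ n u v → dot n (u ⊖ v) ≡ dot n u - dot n v
  dot-⊖ n u v@(v3 v₁ v₂ v₃) =
    trans (dot-⊕ n u -v) (cong (dot n u +_) (inverseˡ-unique (dot n -v) (dot n v) -v+v≡0))
    where
    -v : V3
    -v = v3 (- v₁) (- v₂) (- v₃)

    -v+v≡0 : dot n -v + dot n v ≡ 0#
    -v+v≡0 = begin
      dot n -v + dot n v   ≡⟨ dot-⊕ n -v v ⟨
      dot n (-v ⊕ v)       ≡⟨ cong (dot n) (cong₂ (λ a b → v3 a b ((- v₃) + v₃)) (-‿inverseˡ v₁) (-‿inverseˡ v₂)) ⟩
      dot n (v3 0# 0# ((- v₃) + v₃)) ≡⟨ cong (λ c → dot n (v3 0# 0# c)) (-‿inverseˡ v₃) ⟩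
      dot n zero3          ≡⟨ dot-zero3 n ⟩
      0#                   ∎

  dot-e₁ : ∀ v → dot (v3 1# 0# 0#) v ≡ x v
  dot-e₁ (v3 a b c) = begin
    (1# · a) + ((0# · b) + (0# · c))  ≡⟨ cong₂ _+_ (*-identityˡ a) (cong₂ _+_ (zeroˡ b) (zeroˡ c)) ⟩
    a + (0# + 0#)                     ≡⟨ cong (a +_) (+-identityˡ 0#) ⟩
    a + 0#                            ≡⟨ +-identityʳ a ⟩
    a                                 ∎

  dot-e₂ : ∀ v → dot (v3 0# 1# 0#) v ≡ y v
  dot-e₂ (v3 a b c) = begin
    (0# · a) + ((1# · b) + (0# · c))  ≡⟨ cong₂ _+_ (zeroˡ a) (cong₂ _+_ (*-identityˡ b) (zeroˡ c)) ⟩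
    0# + (b + 0#)                     ≡⟨ +-identityˡ (b + 0#) ⟩
    b + 0#                            ≡⟨ +-identityʳ b ⟩
    b                                 ∎

  dot-e₃ : ∀ v → dot (v3 0# 0# 1#) v ≡ z v
  dot-e₃ (v3 a b c) = begin
    (0# · a) + ((0# · b) + (1# · c))  ≡⟨ cong₂ _+_ (zeroˡ a) (cong₂ _+_ (zeroˡ b) (*-identityˡ c)) ⟩
    0# + (0# + c)                     ≡⟨ +-identityˡ (0# + c) ⟩
    0# + c                            ≡⟨ +-identityˡ c ⟩
    c                                 ∎

  v3-≡ : ∀ {u v} → x u ≡ x v → y u ≡ y v → z u ≡ z v → u ≡ v
  v3-≡ refl refl refl = refl

  dot-injective : ∀ {u v} → (∀ n → dot n u ≡ dot n v) → u ≡ v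
  dot-injective {u} {v} u≈v = v3-≡
    (trans (sym (dot-e₁ u)) (trans (u≈v _) (dot-e₁ v)))
    (trans (sym (dot-e₂ u)) (trans (u≈v _) (dot-e₂ v)))
    (trans (sym (dot-e₃ u)) (trans (u≈v _) (dot-e₃ v)))

  dot-along-line : ∀ n p t d → dot n (p ⊕ (t ⊙ d)) ≡ dot n p + (t · dot n d)
  dot-along-line n p t d = trans (dot-⊕ n p (t ⊙ d)) (cong (dot n p +_) (dot-⊙ n t d))

  OnLine∞⇒dot-constant : ∀ {n d} → OnLine∞ n d → ∀ p s t → dot n (p ⊕ (s ⊙ d)) ≡ dot n (p ⊕ (t ⊙ d))
  OnLine∞⇒dot-constant {n} {d} nd≡0 p s t = trans (dot-at s) (sym (dot-at t))
    where
    dot-at : ∀ r → dot n (p ⊕ (r ⊙ d)) ≡ dot n p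
    dot-at r = begin
      dot n (p ⊕ (r ⊙ d))     ≡⟨ dot-along-line n p r d ⟩
      dot n p + (r · dot n d) ≡⟨ cong (λ w → dot n p + (r · w)) nd≡0 ⟩
      dot n p + (r · 0#)      ≡⟨ cong (dot n p +_) (zeroʳ r) ⟩
      dot n p + 0#            ≡⟨ +-identityʳ (dot n p) ⟩
      dot n p                 ∎

  dot-equal⇒OnLine∞ : ∀ {n p d s t} → s ≢ t → dot n (p ⊕ (s ⊙ d)) ≡ dot n (p ⊕ (t ⊙ d)) → OnLine∞ n d
  dot-equal⇒OnLine∞ {n} {p} {d} {s} {t} s≢t same = x·y≡0⇒y≡0 (x≢y⇒x-y≢0 s≢t) (begin
    (s - t) · dot n d                  ≡⟨ distribʳ (dot n d) s (- t) ⟩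
    (s · dot n d) + ((- t) · dot n d)  ≡⟨ cong ((s · dot n d) +_) (-‿distribˡ-* t (dot n d)) ⟨
    (s · dot n d) - (t · dot n d)      ≡⟨ x≈y⇒x∙y⁻¹≈ε sd≡td ⟩
    0#                                 ∎)
    where
    sd≡td : s · dot n d ≡ t · dot n d
    sd≡td = ∙-cancelˡ (dot n p) _ _
      (trans (sym (dot-along-line n p s d)) (trans same (dot-along-line n p t d)))

  ¬OnLine∞⇒meets-plane : ∀ {n d} → ¬ OnLine∞ n d → ∀ p k → ∃[ t ] InPlane n k (p ⊕ (t ⊙ d))
  ¬OnLine∞⇒meets-plane {n} {d} nd≢0 p k with inv (dot n d) nd≢0
  ... | c⁻¹ , cc⁻¹≡1 =
    (k - dot n p) · c⁻¹ , trans (dot-along-line n p _ d) (x+[y-x]·z⁻¹·z≡y cc⁻¹≡1)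

  line-points-distinct : ∀ {p d s t} → NonZero3 d → s ≢ t → p ⊕ (s ⊙ d) ≢ p ⊕ (t ⊙ d)
  line-points-distinct d≢0 s≢t same = d≢0 (dot-injective λ n →
    trans (dot-equal⇒OnLine∞ s≢t (cong (dot n) same)) (sym (dot-zero3 n)))

  collinearity-equation : ∀ {a b c l μ} → (l ⊙ (b ⊖ a)) ⊕ (μ ⊙ (c ⊖ a)) ≡ zero3 →
    ∀ n → (l · (dot n b - dot n a)) + (μ · (dot n c - dot n a)) ≡ 0#
  collinearity-equation {a} {b} {c} {l} {μ} relation n = begin
    (l · (dot n b - dot n a)) + (μ · (dot n c - dot n a))
      ≡⟨ cong₂ (λ u v → (l · u) + (μ · v)) (dot-⊖ n b a) (dot-⊖ n c a) ⟨
    (l · dot n (b ⊖ a)) + (μ · dot n (c ⊖ a))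
      ≡⟨ cong₂ _+_ (dot-⊙ n l (b ⊖ a)) (dot-⊙ n μ (c ⊖ a)) ⟨
    dot n (l ⊙ (b ⊖ a)) + dot n (μ ⊙ (c ⊖ a))
      ≡⟨ dot-⊕ n (l ⊙ (b ⊖ a)) (μ ⊙ (c ⊖ a)) ⟨
    dot n ((l ⊙ (b ⊖ a)) ⊕ (μ ⊙ (c ⊖ a)))
      ≡⟨ cong (dot n) relation ⟩
    dot n zero3
      ≡⟨ dot-zero3 n ⟩
    0# ∎

  Collinear⇒InPlane : ∀ {a b c n k} → a ≢ b → InPlane n k a → InPlane n k b → Collinear a b c → InPlane n k c
  Collinear⇒InPlane {a} {b} {c} {n} a≢b a∈π b∈π (l , μ , l≢0⊎μ≢0 , relation) with μ ≟ 0#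
  ... | yes refl = contradiction (sym (dot-injective λ n′ → x-y≡0⇒x≡y (x·y≡0⇒y≡0 l≢0 (begin
    l · (dot n′ b - dot n′ a)                                ≡⟨ +-identityʳ _ ⟨
    (l · (dot n′ b - dot n′ a)) + 0#                         ≡⟨ cong ((l · (dot n′ b - dot n′ a)) +_) (zeroˡ (dot n′ c - dot n′ a)) ⟨
    (l · (dot n′ b - dot n′ a)) + (0# · (dot n′ c - dot n′ a)) ≡⟨ collinearity-equation relation n′ ⟩
    0#                                                       ∎)))) a≢b
    where
    l≢0 : l ≢ 0#
    l≢0 = fromInj₁ (contradiction refl) l≢0⊎μ≢0
  ... | no μ≢0 = trans (x-y≡0⇒x≡y (x·y≡0⇒y≡0 μ≢0 (begin
    μ · (dot n c - dot n a)                                ≡⟨ +-identityˡ _ ⟨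
    0# + (μ · (dot n c - dot n a))                         ≡⟨ cong (_+ (μ · (dot n c - dot n a))) l[b-a]≡0 ⟨
    (l · (dot n b - dot n a)) + (μ · (dot n c - dot n a))  ≡⟨ collinearity-equation relation n ⟩
    0#                                                     ∎))) a∈π
    where
    l[b-a]≡0 : l · (dot n b - dot n a) ≡ 0#
    l[b-a]≡0 = begin
      l · (dot n b - dot n a)  ≡⟨ cong (λ w → l · (w - dot n a)) (trans b∈π (sym a∈π)) ⟩
      l · (dot n a - dot n a)  ≡⟨ cong (l ·_) (-‿inverseʳ (dot n a)) ⟩
      l · 0#                   ≡⟨ zeroʳ l ⟩
      0#                       ∎

  -- Only ¬ ¬ Collinear follows from ¬ Determined, whence the double negation.
  ¬Determined⇒¬¬InPlane : ∀ {U n k n′ k′ a b c} → ¬ Determined U n →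
    a ∈ U → b ∈ U → c ∈ U → a ≢ b →
    InPlane n k a → InPlane n k b → InPlane n k c →
    InPlane n′ k′ a → InPlane n′ k′ b → ¬ ¬ InPlane n′ k′ c
  ¬Determined⇒¬¬InPlane ¬det a∈U b∈U c∈U a≢b a∈π b∈π c∈π a∈π′ b∈π′ c∉π′ =
    ¬det (_ , _ , _ , _ , a∈U , b∈U , c∈U , a∈π , b∈π , c∈π ,
          λ collinear → c∉π′ (Collinear⇒InPlane a≢b a∈π′ b∈π′ collinear))

lemma2 : (F : FiniteField) → let open FiniteField F in let open Geometry F in
    (U : List V3) → Unique U → length U ≡ q * q → ¬ ContainedInPlane U →
    (n₁ n₂ : V3) → NonZero3 n₁ → NonZero3 n₂ → ¬ SameLine∞ n₁ n₂ →
    ¬ Determined U n₁ → ¬ Determined U n₂ →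
    (p₀ m : V3) → LineInU U p₀ m → OnLine∞ n₁ m → OnLine∞ n₂ m →
    (p d : V3) → LineInU U p d → OnLine∞ n₁ d → OnLine∞ n₂ d
lemma2 F U _ _ _ n₁ n₂ _ _ _ ¬det₁ ¬det₂ p₀ m (m≢0 , L₀⊆U) n₁m n₂m p d (_ , L⊆U) n₁d =
  decidable-stable (dot n₂ d ≟ 0#) λ n₂d≢0 →
    -- X = p ⊕ (t ⊙ d) and C = p ⊕ ((t + 1#) ⊙ d) are two points of L.
    let t , X∈π₂ = ¬OnLine∞⇒meets-plane n₂d≢0 p (dot n₂ A) in
    ¬Determined⇒¬¬InPlane ¬det₂ A∈U B∈U (L⊆U t) A≢B refl B∈π₂ X∈π₂ refl B∈π₁ λ X∈π₁ →
    ¬Determined⇒¬¬InPlane ¬det₁ A∈U B∈U (L⊆U (t + 1#)) A≢B refl B∈π₁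
      (trans (OnLine∞⇒dot-constant n₁d p (t + 1#) t) X∈π₁) refl B∈π₂ λ C∈π₂ →
    n₂d≢0 (dot-equal⇒OnLine∞ (x+1≢x t) (trans C∈π₂ (sym X∈π₂)))
  where
  open FiniteField F
  open Geometry F
  open GeometryProperties F

  A B : V3
  A = p₀ ⊕ (0# ⊙ m)
  B = p₀ ⊕ (1# ⊙ m)

  A∈U : A ∈ U
  A∈U = L₀⊆U 0#

  B∈U : B ∈ U
  B∈U = L₀⊆U 1#

  A≢B : A ≢ B
  A≢B = line-points-distinct m≢0 0≢1

  B∈π₁ : InPlane n₁ (dot n₁ A) B
  B∈π₁ = OnLine∞⇒dot-constant n₁m p₀ 1# 0#

  B∈π₂ : InPlane n₂ (dot n₂ A) B
  B∈π₂ = OnLine∞⇒dot-constant n₂m p₀ 1# 0#
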